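{- For all integers $0 \leq k \leq n$, $\mathrm{er}(n,k) \leq \mathrm{frst}(n,k)$.
   Context: For $0 \leq k \leq n$: $\Omega_{n,k}$ is the set of words $v=v_1\cdots v_n$ over $\{0,1\}$ with $n-k$ zeroes and $k$ ones; $\Omega''_{n,k}$ is the set of $v \in \Omega_{n,k}$ with $v_1 \leq v_2$, $v_3 \leq v_4$, $\ldots$, $v_{2\lfloor n/2\rfloor-1} \leq v_{2\lfloor n/2\rfloor}$ (no condition on $v_n$ for $n$ odd); and $\mathrm{er}(n,k)=|\Omega''_{n,k}|$. A weak partition is a finite non-decreasing sequence of non-negative integers; $\mathrm{frst}(n,k)$ is the number of weak partitions with exactly $n-k$ parts, each part at most $k$, such that: (a) if $k$ is even, each odd part has even multiplicity; (b) if $k$ is odd, each even part (including $0$) has even multiplicity. -}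

module Defs where

open import Data.Nat using (ℕ; zero; suc; _+_; _≤ᵇ_; _≡ᵇ_)
open import Data.Nat.Base using (_%_)
open import Data.Bool using (Bool; true; false; _∧_; _∨_; not; if_then_else_)
open import Data.List using (List; []; _∷_; map; concatMap; filter; length; upTo)
open import Data.Vec using (Vec; []; _∷_)
open import Relation.Nullary.Decidable using (Dec; yes; no)
open import Data.Bool using (T)
open import Data.Bool.Properties using (T?)

-- Binary words (false = 0, true = 1)

allWords : (n : ℕ) → List (Vec Bool n)
allWords zero = [] ∷ []
allWords (suc n) = concatMap (λ w → (false ∷ w) ∷ (true ∷ w) ∷ []) (allWords n)

ones : ∀ {n} → Vec Bool n → ℕ
ones [] = 0
ones (false ∷ v) = ones v
ones (true ∷ v) = suc (ones v)

_≤bit_ : Bool → Bool → Bool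
true ≤bit false = false
_ ≤bit _ = true

pairCond : ∀ {n} → Vec Bool n → Bool
pairCond [] = true
pairCond (_ ∷ []) = true
pairCond (a ∷ b ∷ v) = (a ≤bit b) ∧ pairCond v

Ω'' : (n k : ℕ) → List (Vec Bool n)
Ω'' n k = filter (λ v → T? ((ones v ≡ᵇ k) ∧ pairCond v)) (allWords n)

er : ℕ → ℕ → ℕ
er n k = length (Ω'' n k)

-- Weak partitions: non-decreasing sequences of naturals, represented as lists

nondecr : (m lo k : ℕ) → List (List ℕ)
nondecr zero lo k = [] ∷ []
nondecr (suc m) lo k =
  concatMap (λ x → map (x ∷_) (nondecr m x k))
            (filter (λ x → T? (lo ≤ᵇ x)) (upTo (suc k)))

weakPartitions : (m k : ℕ) → List (List ℕ)
weakPartitions m k = nondecr m 0 k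

mult : ℕ → List ℕ → ℕ
mult j [] = 0
mult j (x ∷ xs) = if x ≡ᵇ j then suc (mult j xs) else mult j xs

isEven : ℕ → Bool
isEven n = (n % 2) ≡ᵇ 0

allB : {A : Set} → (A → Bool) → List A → Bool
allB f [] = true
allB f (x ∷ xs) = f x ∧ allB f xs

parityCond : ℕ → List ℕ → Bool
parityCond k p =
  allB (λ x → if isEven k
             then (isEven x ∨ isEven (mult x p))
             else (not (isEven x) ∨ isEven (mult x p))) p

frst : ℕ → ℕ → ℕ
frst n k = length (filter (λ p → T? (parityCond k p)) (weakPartitions (n Data.Nat.∸ k) k))

-- Read a word of Ω''_{n,k} in blocks of two letters, keeping count of the
-- number c of ones read so far: a block 00 contributes two parts equal to c,
-- a block 01 contributes one part, c or c + 1, whichever has the parity of k,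
-- a block 11 contributes nothing, and a trailing 0 contributes the part c = k.
-- This yields n - k parts, non-decreasing and at most k, and every part whose
-- parity differs from that of k comes from 00 blocks, so it has even
-- multiplicity.  The word is recovered from its partition, since the parts
-- produced after a block are at least the count c after it, which tells the
-- three kinds of blocks apart.
module Submission where

open import Defs
open import Data.Nat using (ℕ; zero; suc; _+_; _∸_; _≤_; _<_; _≤ᵇ_; _≡ᵇ_; z≤n; s≤s)
open import Data.Nat.Properties
  using (≤-refl; ≤-reflexive; ≤-trans; n≤1+n; m+n≤o⇒m≤o; +-suc; +-identityʳ; m+n∸n≡m; ≡ᵇ⇒≡; ≤⇒≤ᵇ; 1+n≰n)
open import Data.Bool using (Bool; true; false; not; _∧_; _∨_; _xor_; if_then_else_; T)
open import Data.Bool.Properties using (T?; T-∧)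
open import Data.Empty using (⊥-elim)
open import Data.Fin using (Fin; zero; suc)
open import Data.Fin.Properties using (injective⇒≤)
open import Data.Product using (_×_; _,_; proj₁; proj₂; map₁)
open import Data.List using (List; []; _∷_; lookup; length; filter; concatMap; map; cartesianProductWith)
open import Data.List.Properties using (∷-injectiveʳ)
import Data.List.Relation.Unary.All as All
open import Data.List.Relation.Unary.All using (All; []; _∷_)
open import Data.List.Relation.Unary.Unique.Propositional using (Unique; []; _∷_)
import Data.List.Relation.Unary.Unique.Propositional.Properties as Unique
open import Data.List.Membership.Propositional using (_∈_)
open import Data.List.Membership.Propositional.Properties
  using (∈-lookup; ∈-map⁺; ∈-concatMap⁺; ∈-upTo⁺; ∈-filter⁺; ∈-filter⁻)
open import Data.List.Membership.Setoid.Properties using (index-injective)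
import Data.List.Relation.Unary.Any as Any
open import Data.Vec using (Vec; []; _∷_)
open import Data.Vec.Properties using (∷-injective)
open import Function.Bundles using (Equivalence)
open import Relation.Binary.PropositionalEquality
  using (_≡_; _≢_; refl; sym; trans; cong; subst; setoid)

lookup-injective : ∀ {A : Set} {xs : List A} → Unique xs → ∀ {i j} → lookup xs i ≡ lookup xs j → i ≡ j
lookup-injective (_   ∷ _) {zero}  {zero}  _ = refl
lookup-injective (x∉ ∷ _) {zero}  {suc j} e = ⊥-elim (All.lookup x∉ (∈-lookup j) e)
lookup-injective (x∉ ∷ _) {suc i} {zero}  e = ⊥-elim (All.lookup x∉ (∈-lookup i) (sym e))
lookup-injective (_   ∷ u) {suc i} {suc j} e = cong suc (lookup-injective u e)

injectiveOn⇒length≤ : ∀ {A B : Set} (xs : List A) (ys : List B) (f : A → B) → Unique xs →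
                      (∀ {x} → x ∈ xs → f x ∈ ys) →
                      (∀ {x y} → x ∈ xs → y ∈ xs → f x ≡ f y → x ≡ y) →
                      length xs ≤ length ys
injectiveOn⇒length≤ xs ys f uniq into inj = injective⇒≤ position-injective
  where
  position : Fin (length xs) → Fin (length ys)
  position i = Any.index (into (∈-lookup i))

  position-injective : ∀ {i j} → position i ≡ position j → i ≡ j
  position-injective {i} {j} e =
    lookup-injective uniq
      (inj (∈-lookup i) (∈-lookup j) (index-injective (setoid _) (into (∈-lookup i)) (into (∈-lookup j)) e))

allWords≡cartesianProduct : ∀ n →
  allWords (suc n) ≡ cartesianProductWith (λ w b → b ∷ w) (allWords n) (false ∷ true ∷ [])
allWords≡cartesianProduct n = go (allWords n)
  where
  go : ∀ {n} (ws : List (Vec Bool n)) →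
       concatMap (λ w → (false ∷ w) ∷ (true ∷ w) ∷ []) ws ≡
       cartesianProductWith (λ w b → b ∷ w) ws (false ∷ true ∷ [])
  go []       = refl
  go (w ∷ ws) = cong (λ r → (false ∷ w) ∷ (true ∷ w) ∷ r) (go ws)

allWords-unique : ∀ n → Unique (allWords n)
allWords-unique zero    = [] ∷ []
allWords-unique (suc n) =
  subst Unique (sym (allWords≡cartesianProduct n))
    (Unique.cartesianProductWith⁺ (λ w b → b ∷ w) swap-∷-injective (allWords-unique n) bits-unique)
  where
  swap-∷-injective : ∀ {w x : Vec Bool n} {b c} → b ∷ w ≡ c ∷ x → w ≡ x × b ≡ c
  swap-∷-injective e = proj₂ (∷-injective e) , proj₁ (∷-injective e)

  bits-unique : Unique (false ∷ true ∷ [])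
  bits-unique = ((λ ()) ∷ []) ∷ [] ∷ []

∷-∈-nondecr : ∀ {m lo k x xs} → lo ≤ x → x ≤ k → xs ∈ nondecr m x k → (x ∷ xs) ∈ nondecr (suc m) lo k
∷-∈-nondecr {m} {lo} {k} {x} lo≤x x≤k xs∈ =
  ∈-concatMap⁺ (λ y → map (y ∷_) (nondecr m y k))
    (Any.map (λ { refl → ∈-map⁺ (x ∷_) xs∈ })
       (∈-filter⁺ (λ y → T? (lo ≤ᵇ y)) (∈-upTo⁺ (s≤s x≤k)) (≤⇒≤ᵇ lo≤x)))

isEven-suc : ∀ c → isEven (suc c) ≡ not (isEven c)
isEven-suc zero          = refl
isEven-suc (suc zero)    = refl
isEven-suc (suc (suc c)) = isEven-suc c

liftToParity : ℕ → ℕ → ℕ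
liftToParity k c = if isEven c xor isEven k then suc c else c

liftToParity-≥ : ∀ k c → c ≤ liftToParity k c
liftToParity-≥ k c with isEven c xor isEven k
... | true  = n≤1+n c
... | false = ≤-refl

liftToParity-≤ : ∀ k c → liftToParity k c ≤ suc c
liftToParity-≤ k c with isEven c xor isEven k
... | true  = ≤-refl
... | false = n≤1+n c

isEven-liftToParity : ∀ k c → isEven (liftToParity k c) ≡ isEven k
isEven-liftToParity k c = evenness (isEven c) (isEven k) refl
  where
  evenness : ∀ b e → isEven c ≡ b → isEven (if b xor e then suc c else c) ≡ e
  evenness true  true  ec = ec
  evenness false false ec = ec
  evenness true  false ec = trans (isEven-suc c) (cong not ec)
  evenness false true  ec = trans (isEven-suc c) (cong not ec)

zeros : ∀ {n} → Vec Bool n → ℕ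
zeros []          = 0
zeros (false ∷ v) = suc (zeros v)
zeros (true ∷ v)  = zeros v

zeros+ones≡length : ∀ {n} (v : Vec Bool n) → zeros v + ones v ≡ n
zeros+ones≡length []          = refl
zeros+ones≡length (false ∷ v) = cong suc (zeros+ones≡length v)
zeros+ones≡length (true ∷ v)  = trans (+-suc (zeros v) (ones v)) (cong suc (zeros+ones≡length v))

toPartition : ∀ {n} → ℕ → ℕ → Vec Bool n → List ℕ
toPartition k c []                  = []
toPartition k c (false ∷ [])        = c ∷ []
toPartition k c (true ∷ [])         = []
toPartition k c (false ∷ false ∷ v) = c ∷ c ∷ toPartition k c v
toPartition k c (false ∷ true ∷ v)  = liftToParity k c ∷ toPartition k (suc c) v
toPartition k c (true ∷ true ∷ v)   = toPartition k (suc (suc c)) v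
toPartition k c (true ∷ false ∷ v)  = []

toPartition-≥ : ∀ {n} k c (v : Vec Bool n) → All (c ≤_) (toPartition k c v)
toPartition-≥ k c []                  = []
toPartition-≥ k c (false ∷ [])        = ≤-refl ∷ []
toPartition-≥ k c (true ∷ [])         = []
toPartition-≥ k c (false ∷ false ∷ v) = ≤-refl ∷ ≤-refl ∷ toPartition-≥ k c v
toPartition-≥ k c (false ∷ true ∷ v)  =
  liftToParity-≥ k c ∷ All.map (≤-trans (n≤1+n c)) (toPartition-≥ k (suc c) v)
toPartition-≥ k c (true ∷ true ∷ v)   =
  All.map (≤-trans (≤-trans (n≤1+n c) (n≤1+n (suc c)))) (toPartition-≥ k (suc (suc c)) v)
toPartition-≥ k c (true ∷ false ∷ v)  = []

∷-≢-above : ∀ {x d : ℕ} {xs ys : List ℕ} → x < d → All (d ≤_) ys → x ∷ xs ≢ ys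
∷-≢-above x<d (d≤x ∷ _) refl = 1+n≰n (≤-trans x<d d≤x)

toPartition-injective : ∀ {n} k c (v w : Vec Bool n) → T (pairCond v) → T (pairCond w) →
                        toPartition k c v ≡ toPartition k c w → v ≡ w
toPartition-injective k c []           []           _ _ _ = refl
toPartition-injective k c (false ∷ []) (false ∷ []) _ _ _ = refl
toPartition-injective k c (true ∷ [])  (true ∷ [])  _ _ _ = refl
toPartition-injective k c (false ∷ []) (true ∷ [])  _ _ ()
toPartition-injective k c (true ∷ [])  (false ∷ []) _ _ ()
toPartition-injective k c (true ∷ false ∷ v) w () _ _
toPartition-injective k c v (true ∷ false ∷ w) _ () _
toPartition-injective k c (false ∷ false ∷ v) (false ∷ false ∷ w) pv pw e =
  cong (λ u → false ∷ false ∷ u) (toPartition-injective k c v w pv pw (∷-injectiveʳ (∷-injectiveʳ e)))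
toPartition-injective k c (false ∷ true ∷ v) (false ∷ true ∷ w) pv pw e =
  cong (λ u → false ∷ true ∷ u) (toPartition-injective k (suc c) v w pv pw (∷-injectiveʳ e))
toPartition-injective k c (true ∷ true ∷ v) (true ∷ true ∷ w) pv pw e =
  cong (λ u → true ∷ true ∷ u) (toPartition-injective k (suc (suc c)) v w pv pw e)
toPartition-injective k c (false ∷ false ∷ v) (false ∷ true ∷ w) _ _ e =
  ⊥-elim (∷-≢-above ≤-refl (toPartition-≥ k (suc c) w) (∷-injectiveʳ e))
toPartition-injective k c (false ∷ true ∷ v) (false ∷ false ∷ w) _ _ e =
  ⊥-elim (∷-≢-above ≤-refl (toPartition-≥ k (suc c) v) (∷-injectiveʳ (sym e)))
toPartition-injective k c (false ∷ false ∷ v) (true ∷ true ∷ w) _ _ e =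
  ⊥-elim (∷-≢-above (n≤1+n (suc c)) (toPartition-≥ k (suc (suc c)) w) e)
toPartition-injective k c (true ∷ true ∷ v) (false ∷ false ∷ w) _ _ e =
  ⊥-elim (∷-≢-above (n≤1+n (suc c)) (toPartition-≥ k (suc (suc c)) v) (sym e))
toPartition-injective k c (false ∷ true ∷ v) (true ∷ true ∷ w) _ _ e =
  ⊥-elim (∷-≢-above (s≤s (liftToParity-≤ k c)) (toPartition-≥ k (suc (suc c)) w) e)
toPartition-injective k c (true ∷ true ∷ v) (false ∷ true ∷ w) _ _ e =
  ⊥-elim (∷-≢-above (s≤s (liftToParity-≤ k c)) (toPartition-≥ k (suc (suc c)) v) (sym e))

+-suc-shift : ∀ c m {k} → c + suc m ≡ k → suc c + m ≡ k
+-suc-shift c m e = trans (sym (+-suc c m)) e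

toPartition-∈-nondecr : ∀ {n} k c lo (v : Vec Bool n) → T (pairCond v) → lo ≤ c → c + ones v ≡ k →
                        toPartition k c v ∈ nondecr (zeros v) lo k
toPartition-∈-nondecr k c lo []           _ _ _ = Any.here refl
toPartition-∈-nondecr k c lo (true ∷ [])  _ _ _ = Any.here refl
toPartition-∈-nondecr k c lo (false ∷ []) _ lo≤c e =
  ∷-∈-nondecr {m = 0} lo≤c (m+n≤o⇒m≤o c (≤-reflexive e)) (Any.here refl)
toPartition-∈-nondecr k c lo (false ∷ false ∷ v) pv lo≤c e =
  ∷-∈-nondecr {m = suc (zeros v)} lo≤c c≤k
    (∷-∈-nondecr {m = zeros v} ≤-refl c≤k (toPartition-∈-nondecr k c c v pv ≤-refl e))
  where c≤k = m+n≤o⇒m≤o c (≤-reflexive e)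
toPartition-∈-nondecr k c lo (false ∷ true ∷ v) pv lo≤c e =
  ∷-∈-nondecr {m = zeros v} (≤-trans lo≤c (liftToParity-≥ k c))
    (≤-trans (liftToParity-≤ k c) (m+n≤o⇒m≤o (suc c) (≤-reflexive e′)))
    (toPartition-∈-nondecr k (suc c) _ v pv (liftToParity-≤ k c) e′)
  where e′ = +-suc-shift c (ones v) e
toPartition-∈-nondecr k c lo (true ∷ true ∷ v) pv lo≤c e =
  toPartition-∈-nondecr k (suc (suc c)) lo v pv (≤-trans lo≤c (≤-trans (n≤1+n c) (n≤1+n (suc c))))
    (+-suc-shift (suc c) (ones v) (+-suc-shift c (suc (ones v)) e))

data Paired (e : Bool) : List ℕ → Set where
  []     : Paired e []
  pair   : ∀ c {p} → Paired e p → Paired e (c ∷ c ∷ p)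
  single : ∀ {x p} → isEven x ≡ e → Paired e p → Paired e (x ∷ p)

isEven-mult-Paired : ∀ {e p} x → Paired e p → isEven x ≢ e → T (isEven (mult x p))
isEven-mult-Paired x []          _ = _
isEven-mult-Paired x (pair c paired) x≢e with c ≡ᵇ x
... | true  = isEven-mult-Paired x paired x≢e
... | false = isEven-mult-Paired x paired x≢e
isEven-mult-Paired x (single {y} y≡e paired) x≢e with y ≡ᵇ x | ≡ᵇ⇒≡ y x
... | true  | y≡x = ⊥-elim (x≢e (trans (cong isEven (sym (y≡x _))) y≡e))
... | false | _   = isEven-mult-Paired x paired x≢e

toPartition-Paired : ∀ {n} k c (v : Vec Bool n) → T (pairCond v) → c + ones v ≡ k →
                     Paired (isEven k) (toPartition k c v)
toPartition-Paired k c []                  _  _ = []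
toPartition-Paired k c (true ∷ [])         _  _ = []
toPartition-Paired k c (false ∷ [])        _  e = single (cong isEven (trans (sym (+-identityʳ c)) e)) []
toPartition-Paired k c (false ∷ false ∷ v) pv e = pair c (toPartition-Paired k c v pv e)
toPartition-Paired k c (false ∷ true ∷ v)  pv e =
  single (isEven-liftToParity k c) (toPartition-Paired k (suc c) v pv (+-suc-shift c (ones v) e))
toPartition-Paired k c (true ∷ true ∷ v)   pv e =
  toPartition-Paired k (suc (suc c)) v pv (+-suc-shift (suc c) (ones v) (+-suc-shift c (suc (ones v)) e))

allB-universal : ∀ {A : Set} (f : A → Bool) → (∀ x → T (f x)) → ∀ xs → T (allB f xs)
allB-universal f all-f []       = _
allB-universal f all-f (x ∷ xs) with f x | all-f x
... | true | _ = allB-universal f all-f xs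

Paired⇒parityCond : ∀ k {p} → Paired (isEven k) p → T (parityCond k p)
Paired⇒parityCond k {p} paired =
  allB-universal _ (λ x → condition (isEven k) (isEven x) (isEven-mult-Paired x paired)) p
  where
  condition : ∀ e b {m} → (b ≢ e → T m) → T (if e then (b ∨ m) else (not b ∨ m))
  condition true  true  _ = _
  condition false false _ = _
  condition true  false h = h (λ ())
  condition false true  h = h (λ ())

∈-Ω'' : ∀ {n k v} → v ∈ Ω'' n k → ones v ≡ k × T (pairCond v)
∈-Ω'' {n} {k} {v} v∈ =
  map₁ (≡ᵇ⇒≡ (ones v) k) (Equivalence.to T-∧ (proj₂ (∈-filter⁻ (λ w → T? ((ones w ≡ᵇ k) ∧ pairCond w)) {xs = allWords n} v∈)))

zeros≡length∸ones : ∀ {n} (v : Vec Bool n) → zeros v ≡ n ∸ ones v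
zeros≡length∸ones v = trans (sym (m+n∸n≡m (zeros v) (ones v))) (cong (_∸ ones v) (zeros+ones≡length v))

frstPartitions : ℕ → ℕ → List (List ℕ)
frstPartitions n k = filter (λ p → T? (parityCond k p)) (weakPartitions (n ∸ k) k)

toPartition-∈-frstPartitions : ∀ {n k v} → v ∈ Ω'' n k → toPartition k 0 v ∈ frstPartitions n k
toPartition-∈-frstPartitions {n} {k} {v} v∈ with ∈-Ω'' v∈
... | refl , pv = ∈-filter⁺ (λ p → T? (parityCond k p))
  (subst (λ m → toPartition k 0 v ∈ nondecr m 0 k) (zeros≡length∸ones v)
    (toPartition-∈-nondecr k 0 0 v pv z≤n refl))
  (Paired⇒parityCond k (toPartition-Paired k 0 v pv refl))

theorem3p6 : (n k : ℕ) → k ≤ n → er n k ≤ frst n k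
theorem3p6 n k _ =
  injectiveOn⇒length≤ (Ω'' n k) (frstPartitions n k) (toPartition k 0)
    (Unique.filter⁺ _ (allWords-unique n)) toPartition-∈-frstPartitions
    (λ v∈ w∈ → toPartition-injective k 0 _ _ (proj₂ (∈-Ω'' v∈)) (proj₂ (∈-Ω'' w∈)))
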